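{- Let $n\ge 2$ and let $t_1,\dots,t_n$ be nonnegative integers. If there exists an index $i$ with $t_i>t_1$, then $$P(t_1+1,t_2,\ldots,t_n)\ge P(t_1,t_2,\ldots,t_n).$$
   Context: For pairwise disjoint finite sets $T_1,\dots,T_n$ with $|T_i|=t_i$, a generalized derangement (GD) is a permutation $\sigma$ of $\bigcup_{i=1}^n T_i$ such that $\sigma(a)\notin T_i$ for every $i$ and every $a\in T_i$. $P(t_1,\dots,t_n)$ denotes the number of GDs; it depends only on the sizes $t_i$. -}

module Defs where

open import Data.Nat using (ℕ; zero; suc)
open import Data.Fin using (Fin; zero; suc)
open import Data.Fin.Properties using (_≟_)
open import Data.Vec using (Vec; []; _∷_; replicate; lookup; toList; sum; allFin) renaming (map to vmap; _++_ to _+++_)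
open import Data.List using (List; []; _∷_; [_]; concatMap; map; filter; length)
open import Data.List.Relation.Unary.Unique.Propositional using (Unique)
open import Data.List.Relation.Unary.Unique.DecPropositional using (unique?)
open import Data.Vec.Relation.Unary.All using (All; all?)
open import Data.Product using (_×_)
open import Relation.Binary.PropositionalEquality using (_≢_)
open import Relation.Nullary using (Dec; ¬?)
open import Relation.Nullary.Decidable using (_×-dec_)

-- Ground set for sizes t = (t_1,...,t_n): the disjoint union of the T_i,
-- realised as Fin (t_1 + ... + t_n); element a lies in block (labels t) [a].
labels : ∀ {n} (t : Vec ℕ n) → Vec (Fin n) (sum t)
labels [] = []
labels (x ∷ xs) = replicate x zero +++ vmap suc (labels xs)

allVecs : (N m : ℕ) → List (Vec (Fin N) m)
allVecs N zero = [ [] ]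
allVecs N (suc m) = concatMap (λ v → map (_∷ v) (Data.Vec.toList (allFin N))) (allVecs N m)

-- σ (a lookup table Fin N → Fin N) is a generalized derangement:
-- σ is a permutation (injective, hence bijective, on the finite set) and
-- σ(a) is never in the same block as a.
IsGD : ∀ {n} (t : Vec ℕ n) → Vec (Fin (sum t)) (sum t) → Set
IsGD t σ = Unique (toList σ) × All (λ a → lookup (labels t) (lookup σ a) ≢ lookup (labels t) a) (allFin (sum t))

isGD? : ∀ {n} (t : Vec ℕ n) (σ : Vec (Fin (sum t)) (sum t)) → Dec (IsGD t σ)
isGD? t σ = unique? _≟_ (toList σ) ×-dec all? (λ a → ¬? (lookup (labels t) (lookup σ a) ≟ lookup (labels t) a)) (allFin (sum t))

P : ∀ {n} → Vec ℕ n → ℕ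
P t = length (filter (isGD? t) (allVecs (sum t) (sum t)))

module Submission where

-- Let t = (t₁, t₂, …, tₙ) with blocks
-- T₁, …, Tₙ and let t' = (t₁+1, t₂, …, tₙ), whose ground set is that of t
-- plus one new point 0 placed in the first block.  Given a generalized
-- derangement σ for t, pick a point x ∉ T₁ with σ(x) ∉ T₁; such an x exists
-- because σ is injective and some block Tᵢ is larger than T₁, so σ cannot
-- send all of Tᵢ into T₁ (pigeonhole).  Splicing the new point into the
-- cycle of σ after x (x ↦ 0 ↦ σ(x)) gives a generalized derangement for t',
-- and σ is recovered from it by "short-circuiting" the new point.  Hence
-- σ ↦ splice is injective and P(t) ≤ P(t').

open import Defs
open import Data.Nat using (ℕ; suc; _≤_; _<_; _≥_)
open import Data.Fin using (Fin)
open import Data.Vec using (Vec; _∷_; lookup)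
open import Data.Product using (∃)

open import Data.Nat using (zero; z≤n; s≤s; _+_)
open import Data.Nat.Properties using (≤-trans; ≤-reflexive; <⇒≱; +-identityʳ)
open import Data.Fin using (zero; suc)
open import Data.Fin.Properties using (_≟_; any?; 0≢1+n; suc-injective)
import Data.Vec as V
import Data.Vec.Properties as VP
import Data.Vec.Relation.Unary.All.Properties as VAllP
open import Data.List
  using (List; []; _∷_; map; filter; length; tabulate; allFin; concatMap; cartesianProductWith; _++_)
import Data.List.Properties as LP
import Data.List.Relation.Unary.All as LAll
import Data.List.Relation.Unary.All.Properties as LAllP
open import Data.List.Relation.Unary.Any using (here; there)
open import Data.List.Relation.Unary.AllPairs as AllPairs using (_∷_)
open import Data.List.Relation.Unary.Unique.Propositional using (Unique)
import Data.List.Relation.Unary.Unique.Propositional.Properties as UP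
open import Data.List.Membership.Propositional using (_∈_)
import Data.List.Membership.Propositional.Properties as MP
open import Data.Product using (_×_; _,_; proj₁; proj₂)
open import Data.Empty using (⊥-elim)
open import Relation.Nullary using (yes; no; does; ¬?; _×-dec_; contradiction)
open import Relation.Nullary.Decidable using (decidable-stable)
open import Relation.Unary using (Pred; Decidable)
open import Relation.Binary.PropositionalEquality
  using (_≡_; refl; sym; trans; cong; cong₂; subst; subst₂; _≢_; module ≡-Reasoning)
open import Function using (_∘_; id)
open import Function.Definitions using (Injective)
open import Data.Bool using (true; false)

module _ {a} {A : Set a} where

  remove : ∀ {x : A} (ys : List A) → x ∈ ys → List A
  remove (y ∷ ys) (here _)  = ys
  remove (y ∷ ys) (there p) = y ∷ remove ys p

  length-remove : ∀ {x : A} (ys : List A) (p : x ∈ ys) → suc (length (remove ys p)) ≡ length ys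
  length-remove (y ∷ ys) (here _)  = refl
  length-remove (y ∷ ys) (there p) = cong suc (length-remove ys p)

  ∈-remove : ∀ {x z : A} (ys : List A) (p : x ∈ ys) → z ∈ ys → z ≢ x → z ∈ remove ys p
  ∈-remove (y ∷ ys) (here refl) (here refl) z≢x = ⊥-elim (z≢x refl)
  ∈-remove (y ∷ ys) (here refl) (there q)   z≢x = q
  ∈-remove (y ∷ ys) (there p)   (here refl) z≢x = here refl
  ∈-remove (y ∷ ys) (there p)   (there q)   z≢x = there (∈-remove ys p q z≢x)

  unique-⊆⇒length≤ : ∀ (xs ys : List A) → Unique xs → (∀ {z} → z ∈ xs → z ∈ ys) →
                     length xs ≤ length ys
  unique-⊆⇒length≤ []       ys u         xs⊆ys = z≤n
  unique-⊆⇒length≤ (x ∷ xs) ys (x∉xs ∷ u) xs⊆ys =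
    ≤-trans (s≤s (unique-⊆⇒length≤ xs (remove ys x∈ys) u xs⊆ys-x)) (≤-reflexive (length-remove ys x∈ys))
    where
    x∈ys = xs⊆ys (here refl)
    xs⊆ys-x : ∀ {z} → z ∈ xs → z ∈ remove ys x∈ys
    xs⊆ys-x z∈xs = ∈-remove ys x∈ys (xs⊆ys (there z∈xs)) (λ z≡x → LAll.lookup x∉xs z∈xs (sym z≡x))

  length≤-by-section : ∀ {b} {B : Set b} (g : B → A) (xs : List A) (ys : List B) → Unique xs →
                       (∀ {x} → x ∈ xs → ∃ λ y → y ∈ ys × g y ≡ x) → length xs ≤ length ys
  length≤-by-section g xs ys u covered =
    subst (length xs ≤_) (LP.length-map g ys) (unique-⊆⇒length≤ xs (map g ys) u xs⊆gys)
    where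
    xs⊆gys : ∀ {x} → x ∈ xs → x ∈ map g ys
    xs⊆gys x∈xs with covered x∈xs
    ... | y , y∈ys , refl = MP.∈-map⁺ g y∈ys

  length-filter-map : ∀ {b p} {B : Set b} {P : Pred B p} (P? : Decidable P) (f : A → B) xs →
                      length (filter P? (map f xs)) ≡ length (filter (P? ∘ f) xs)
  length-filter-map P? f []       = refl
  length-filter-map P? f (x ∷ xs) with does (P? (f x))
  ... | false = length-filter-map P? f xs
  ... | true  = cong suc (length-filter-map P? f xs)

  toList-tabulate : ∀ {n} (f : Fin n → A) → V.toList (V.tabulate f) ≡ tabulate f
  toList-tabulate {zero}  f = refl
  toList-tabulate {suc n} f = cong (f zero ∷_) (toList-tabulate (f ∘ suc))

  toList≡tabulate-lookup : ∀ {n} (v : Vec A n) → V.toList v ≡ tabulate (lookup v)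
  toList≡tabulate-lookup v = trans (cong V.toList (sym (VP.tabulate∘lookup v))) (toList-tabulate (lookup v))

  unique-tabulate⇒injective : ∀ {n} (f : Fin n → A) → Unique (tabulate f) → Injective _≡_ _≡_ f
  unique-tabulate⇒injective f u {zero}  {zero}  eq = refl
  unique-tabulate⇒injective f (f0∉ ∷ u) {zero}  {suc j} eq = ⊥-elim (LAllP.tabulate⁻ f0∉ j eq)
  unique-tabulate⇒injective f (f0∉ ∷ u) {suc i} {zero}  eq = ⊥-elim (LAllP.tabulate⁻ f0∉ i (sym eq))
  unique-tabulate⇒injective f (f0∉ ∷ u) {suc i} {suc j} eq =
    cong suc (unique-tabulate⇒injective (f ∘ suc) u eq)

private
  allVecs-step : ∀ {N m} (vs : List (Vec (Fin N) m)) →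
    concatMap (λ v → map (_∷ v) (V.toList (V.allFin N))) vs
      ≡ cartesianProductWith (λ v a → a ∷ v) vs (allFin N)
  allVecs-step {N} []       = refl
  allVecs-step {N} (v ∷ vs) =
    cong₂ _++_ (cong (map (_∷ v)) (toList-tabulate id)) (allVecs-step vs)

allVecs-unique : ∀ N m → Unique (allVecs N m)
allVecs-unique N zero    = LAll.[] ∷ AllPairs.[]
allVecs-unique N (suc m) = subst Unique (sym (allVecs-step (allVecs N m)))
  (UP.cartesianProductWith⁺ (λ v a → a ∷ v) ∷-injective (allVecs-unique N m) (UP.allFin⁺ N))
  where
  ∷-injective : ∀ {w x : Vec (Fin N) m} {y z} → (y ∷ w) ≡ (z ∷ x) → w ≡ x × y ≡ z
  ∷-injective refl = refl , refl

allVecs-complete : ∀ N m (v : Vec (Fin N) m) → v ∈ allVecs N m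
allVecs-complete N zero    V.[]    = here refl
allVecs-complete N (suc m) (a ∷ v) = subst ((a ∷ v) ∈_) (sym (allVecs-step (allVecs N m)))
  (MP.∈-cartesianProductWith⁺ (λ v a → a ∷ v) (allVecs-complete N m v) (MP.∈-allFin a))

GDs : ∀ {n} (t : Vec ℕ n) → List (Vec (Fin (V.sum t)) (V.sum t))
GDs t = filter (isGD? t) (allVecs (V.sum t) (V.sum t))

GDs-unique : ∀ {n} (t : Vec ℕ n) → Unique (GDs t)
GDs-unique t = UP.filter⁺ (isGD? t) (allVecs-unique _ _)

Deranges : ∀ {k N} → Vec (Fin k) N → (Fin N → Fin N) → Set
Deranges L f = ∀ a → lookup L (f a) ≢ lookup L a

isGD⁻ : ∀ {n} (t : Vec ℕ n) {σ} → σ ∈ GDs t →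
        Injective _≡_ _≡_ (lookup σ) × Deranges (labels t) (lookup σ)
isGD⁻ t {σ} σ∈ with proj₂ (MP.∈-filter⁻ (isGD? t) {xs = allVecs _ _} σ∈)
... | unique , deranges =
  unique-tabulate⇒injective (lookup σ) (subst Unique (toList≡tabulate-lookup σ) unique) ,
  VAllP.tabulate⁻ deranges

isGD⁺ : ∀ {n} (t : Vec ℕ n) {f} → Injective _≡_ _≡_ f → Deranges (labels t) f →
        V.tabulate f ∈ GDs t
isGD⁺ t {f} f-inj f-der = MP.∈-filter⁺ (isGD? t) (allVecs-complete _ _ _)
  ( subst Unique (sym (toList-tabulate f)) (UP.tabulate⁺ f-inj)
  , VAllP.tabulate⁺ {f = id} (λ a → subst (λ z → lookup (labels t) z ≢ lookup (labels t) a)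
                                         (sym (VP.lookup∘tabulate f a)) (f-der a)))

blockSize : ∀ {k N} → Fin k → Vec (Fin k) N → ℕ
blockSize {N = N} c L = length (filter (λ x → lookup L x ≟ c) (allFin N))

occurrences : ∀ {k N} → Fin k → Vec (Fin k) N → ℕ
occurrences c L = length (filter (_≟ c) (V.toList L))

blockSize≡occurrences : ∀ {k N} (c : Fin k) (L : Vec (Fin k) N) → blockSize c L ≡ occurrences c L
blockSize≡occurrences {N = N} c L = begin
  length (filter (λ x → lookup L x ≟ c) (allFin N))  ≡⟨ length-filter-map (_≟ c) (lookup L) (allFin N) ⟨
  length (filter (_≟ c) (map (lookup L) (allFin N))) ≡⟨ cong (length ∘ filter (_≟ c)) (LP.map-tabulate id (lookup L)) ⟩
  length (filter (_≟ c) (tabulate (lookup L)))       ≡⟨ cong (length ∘ filter (_≟ c)) (toList≡tabulate-lookup L) ⟨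
  occurrences c L                                    ∎
  where open ≡-Reasoning

occurrences-zero-replicate : ∀ {k N} t (L : Vec (Fin (suc k)) N) →
  occurrences zero (V.replicate t zero V.++ L) ≡ t + occurrences zero L
occurrences-zero-replicate zero    L = refl
occurrences-zero-replicate (suc t) L = cong suc (occurrences-zero-replicate t L)

occurrences-suc-replicate : ∀ {k N} t (i : Fin k) (L : Vec (Fin (suc k)) N) →
  occurrences (suc i) (V.replicate t zero V.++ L) ≡ occurrences (suc i) L
occurrences-suc-replicate zero    i L = refl
occurrences-suc-replicate (suc t) i L = occurrences-suc-replicate t i L

occurrences-zero-map-suc : ∀ {k N} (L : Vec (Fin k) N) → occurrences zero (V.map suc L) ≡ 0
occurrences-zero-map-suc V.[]    = refl
occurrences-zero-map-suc (x ∷ L) = occurrences-zero-map-suc L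

occurrences-suc-map-suc : ∀ {k N} (i : Fin k) (L : Vec (Fin k) N) →
  occurrences (suc i) (V.map suc L) ≡ occurrences i L
occurrences-suc-map-suc i V.[]    = refl
occurrences-suc-map-suc i (x ∷ L) with x ≟ i
... | yes _ = cong suc (occurrences-suc-map-suc i L)
... | no  _ = occurrences-suc-map-suc i L

blockSize-labels : ∀ {n} (t : Vec ℕ n) (i : Fin n) → blockSize i (labels t) ≡ lookup t i
blockSize-labels t i = trans (blockSize≡occurrences i (labels t)) (occurrences-labels t i)
  where
  occurrences-labels : ∀ {n} (t : Vec ℕ n) (i : Fin n) → occurrences i (labels t) ≡ lookup t i
  occurrences-labels (t ∷ ts) zero = begin
    occurrences zero (V.replicate t zero V.++ V.map suc (labels ts)) ≡⟨ occurrences-zero-replicate t _ ⟩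
    t + occurrences zero (V.map suc (labels ts))                     ≡⟨ cong (t +_) (occurrences-zero-map-suc (labels ts)) ⟩
    t + 0                                                            ≡⟨ +-identityʳ t ⟩
    t                                                                ∎
    where open ≡-Reasoning
  occurrences-labels (t ∷ ts) (suc i) = begin
    occurrences (suc i) (V.replicate t zero V.++ V.map suc (labels ts)) ≡⟨ occurrences-suc-replicate t i _ ⟩
    occurrences (suc i) (V.map suc (labels ts))                         ≡⟨ occurrences-suc-map-suc i (labels ts) ⟩
    occurrences i (labels ts)                                           ≡⟨ occurrences-labels ts i ⟩
    lookup ts i                                                         ∎
    where open ≡-Reasoning

injective⇒count≤ : ∀ {N p q} {P : Pred (Fin N) p} {Q : Pred (Fin N) q}
  (P? : Decidable P) (Q? : Decidable Q) {f : Fin N → Fin N} → Injective _≡_ _≡_ f →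
  (∀ {x} → P x → Q (f x)) → length (filter P? (allFin N)) ≤ length (filter Q? (allFin N))
injective⇒count≤ {N} P? Q? {f} f-inj P⇒Q∘f =
  subst (_≤ _) (LP.length-map f Ps) (unique-⊆⇒length≤ (map f Ps) _ fPs-unique fPs⊆Qs)
  where
  Ps = filter P? (allFin N)
  fPs-unique : Unique (map f Ps)
  fPs-unique = UP.map⁺ f-inj (UP.filter⁺ P? (UP.allFin⁺ N))
  fPs⊆Qs : ∀ {z} → z ∈ map f Ps → z ∈ filter Q? (allFin N)
  fPs⊆Qs z∈ with MP.∈-map⁻ f z∈
  ... | x , x∈Ps , refl =
    MP.∈-filter⁺ Q? (MP.∈-allFin (f x)) (P⇒Q∘f (proj₂ (MP.∈-filter⁻ P? {xs = allFin N} x∈Ps)))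

escape : ∀ {k N} (L : Vec (Fin k) N) (c d : Fin k) {f : Fin N → Fin N} → Injective _≡_ _≡_ f →
         blockSize c L < blockSize d L → ∃ λ x → lookup L x ≡ d × lookup L (f x) ≢ c
escape L c d {f} f-inj c<d with any? (λ x → (lookup L x ≟ d) ×-dec ¬? (lookup L (f x) ≟ c))
... | yes found = found
... | no  none  = contradiction (injective⇒count≤ (λ x → lookup L x ≟ d) (λ x → lookup L x ≟ c) f-inj d⇒c)
                                (<⇒≱ c<d)
  where
  d⇒c : ∀ {x} → lookup L x ≡ d → lookup L (f x) ≡ c
  d⇒c {x} Lx≡d = decidable-stable (lookup L (f x) ≟ c) (λ Lfx≢c → none (x , Lx≡d , Lfx≢c))

-- splice f x acts on {0} ∪ (1 + Fin N): it agrees with f on the old points,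
-- except that x ↦ 0 ↦ f x.
splice : ∀ {N} → (Fin N → Fin N) → Fin N → Fin (suc N) → Fin (suc N)
splice f x zero    = suc (f x)
splice f x (suc y) with y ≟ x
... | yes _ = zero
... | no  _ = suc (f y)

splice-injective : ∀ {N} {f : Fin N → Fin N} (x : Fin N) → Injective _≡_ _≡_ f →
                   Injective _≡_ _≡_ (splice f x)
splice-injective x f-inj {zero}  {zero}  eq = refl
splice-injective x f-inj {zero}  {suc j} eq with j ≟ x
... | yes _   = ⊥-elim (0≢1+n (sym eq))
... | no  j≢x = ⊥-elim (j≢x (sym (f-inj (suc-injective eq))))
splice-injective x f-inj {suc i} {zero}  eq with i ≟ x
... | yes _   = ⊥-elim (0≢1+n eq)
... | no  i≢x = ⊥-elim (i≢x (f-inj (suc-injective eq)))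
splice-injective x f-inj {suc i} {suc j} eq with i ≟ x | j ≟ x
... | yes i≡x | yes j≡x = cong suc (trans i≡x (sym j≡x))
... | yes _   | no  _   = ⊥-elim (0≢1+n eq)
... | no  _   | yes _   = ⊥-elim (0≢1+n (sym eq))
... | no  _   | no  _   = cong suc (f-inj (suc-injective eq))

splice-deranges : ∀ {k N} (L : Vec (Fin k) N) (c : Fin k) {f : Fin N → Fin N} {x : Fin N} →
                  Deranges L f → lookup L x ≢ c → lookup L (f x) ≢ c → Deranges (c ∷ L) (splice f x)
splice-deranges L c f-der Lx≢c Lfx≢c zero = Lfx≢c
splice-deranges L c {x = x} f-der Lx≢c Lfx≢c (suc y) with y ≟ x
... | yes refl = λ c≡Lx → Lx≢c (sym c≡Lx)
... | no  _    = f-der y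

-- The image of y after short-circuiting the point 0, given τ(1+y) and τ(0).
shortCircuit : ∀ {N} → Fin N → Fin (suc N) → Fin (suc N) → Fin N
shortCircuit y (suc z) _       = z
shortCircuit y zero    (suc z) = z
shortCircuit y zero    zero    = y

unsplice : ∀ {N} → Vec (Fin (suc N)) (suc N) → Vec (Fin N) N
unsplice τ = V.tabulate (λ y → shortCircuit y (lookup τ (suc y)) (lookup τ zero))

unsplice-splice : ∀ {N} (σ : Vec (Fin N) N) (x : Fin N) → unsplice (V.tabulate (splice (lookup σ) x)) ≡ σ
unsplice-splice σ x = trans (VP.tabulate-cong pointwise) (VP.tabulate∘lookup σ)
  where
  τ = splice (lookup σ) x
  shortCircuit-splice : ∀ y → shortCircuit y (τ (suc y)) (τ zero) ≡ lookup σ y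
  shortCircuit-splice y with y ≟ x
  ... | yes refl = refl
  ... | no  _    = refl
  pointwise : ∀ y → shortCircuit y (lookup (V.tabulate τ) (suc y)) (lookup (V.tabulate τ) zero) ≡ lookup σ y
  pointwise y = trans (cong₂ (shortCircuit y) (VP.lookup∘tabulate τ (suc y)) (VP.lookup∘tabulate τ zero))
                      (shortCircuit-splice y)

GD-extends : ∀ {m} (t₁ : ℕ) (ts : Vec ℕ m) (i : Fin m) → t₁ < lookup ts i →
             ∀ {σ} → σ ∈ GDs (t₁ ∷ ts) → ∃ λ τ → τ ∈ GDs (suc t₁ ∷ ts) × unsplice τ ≡ σ
GD-extends t₁ ts i t₁<tᵢ {σ} σ∈ =
  V.tabulate (splice (lookup σ) x) ,
  isGD⁺ (suc t₁ ∷ ts) (splice-injective x σ-inj) (splice-deranges L zero σ-der Lx≢0 Lσx≢0) ,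
  unsplice-splice σ x
  where
  L = labels (t₁ ∷ ts)
  σ-inj = proj₁ (isGD⁻ (t₁ ∷ ts) σ∈)
  σ-der = proj₂ (isGD⁻ (t₁ ∷ ts) σ∈)
  block₁<blockᵢ : blockSize zero L < blockSize (suc i) L
  block₁<blockᵢ = subst₂ _<_ (sym (blockSize-labels (t₁ ∷ ts) zero))
                             (sym (blockSize-labels (t₁ ∷ ts) (suc i))) t₁<tᵢ
  escaped = escape L zero (suc i) σ-inj block₁<blockᵢ
  x = proj₁ escaped
  Lx≢0 : lookup L x ≢ zero
  Lx≢0 Lx≡0 = 0≢1+n (trans (sym Lx≡0) (proj₁ (proj₂ escaped)))
  Lσx≢0 = proj₂ (proj₂ escaped)

theorem4p5 : (m : ℕ) → 1 ≤ m → (t₁ : ℕ) → (ts : Vec ℕ m) →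
    ∃ (λ (i : Fin m) → t₁ < lookup ts i) →
    P (suc t₁ ∷ ts) ≥ P (t₁ ∷ ts)
theorem4p5 m _ t₁ ts (i , t₁<tᵢ) =
  length≤-by-section unsplice (GDs (t₁ ∷ ts)) (GDs (suc t₁ ∷ ts))
    (GDs-unique (t₁ ∷ ts)) (GD-extends t₁ ts i t₁<tᵢ)
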